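{- Let $P$ be a (possibly infinite) set of classical patterns and $A=\mathrm{Av}(P)$. Let $n,m$ be positive integers, let $A_{\le n}$ be the set of permutations in $A$ of length at most $n$, and let $\mathsf{Mine}(A_{\le n},m)$ be as defined in the context. If $(q,\mathrm{sh}_q)$ is in the output of $\mathsf{Mine}(A_{\le n},m)$ and $\mathrm{sh}_q\neq\emptyset$, then $q\notin P$ and $\mathrm{sh}_q$ consists only of the full shading $\{0,\dots,k\}\times\{0,\dots,k\}$ of $q$ (where $k$ is the length of $q$).
   Context: A permutation $\pi$ contains a classical pattern $p$ (a permutation of length $k$) if there are indices $j_1<\dots<j_k$ with $\mathrm{fl}(\pi_{j_1}\cdots\pi_{j_k})=p$, where $\mathrm{fl}(w)$ replaces the $i$-th smallest letter of $w$ by $i$; $\mathrm{Av}(P)$ is the set of permutations avoiding every pattern in $P$. A mesh pattern is a pair $(p,R)$ with $p$ a permutation of length $k$ and $R\subseteq\{0,\dots,k\}^2$. For an occurrence $j_1<\dots<j_k$ of $p$ in $\pi$ of length $n$, set $j_0=0$, $j_{k+1}=n+1$ and let $v_0<\dots<v_{k+1}$ be $0$, the sorted values $\pi_{j_i}$, and $n+1$; the box $(a,b)$ is empty if no index $x$ has $j_a<x<j_{a+1}$ and $v_b<\pi_x<v_{b+1}$. The maximal shading of the occurrence is the set of all empty boxes. The algorithm $\mathsf{Mine}(B,m)$ (for a finite set $B$ of permutations) outputs, for every classical pattern $p$ of length at most $m$, the pair $(p,\mathrm{sh}_p)$, where $\mathrm{sh}_p$ is the set of inclusion-maximal elements among the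 maximal shadings of all occurrences of $p$ in all permutations of $B$ ($\mathrm{sh}_p=\emptyset$ if $p$ occurs in no permutation of $B$). -}

module Defs where

open import Data.Nat using (ℕ; zero; suc; _≤_; _<_; _<?_; _∸_)
open import Data.Nat.Properties using (≤-decTotalOrder)
open import Data.Bool using (Bool; true)
open import Data.Fin using (Fin; toℕ)
open import Data.List using (List; []; _∷_; length; map; filter; upTo; _++_; [_])
open import Data.List.Relation.Unary.All using (All)
open import Data.List.Relation.Unary.Linked using (Linked)
open import Data.List.Relation.Binary.Permutation.Propositional using (_↭_)
open import Data.List.Sort ≤-decTotalOrder using (sort)
open import Data.Vec using (Vec; lookup; replicate)
open import Data.Product using (_×_; ∃; ∃-syntax)
open import Relation.Binary.PropositionalEquality using (_≡_)
open import Relation.Nullary using (¬_)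
open import Function.Bundles using (_⇔_)

-- 0-based lookup with default 0
nth : List ℕ → ℕ → ℕ
nth []       _       = 0
nth (x ∷ _)  zero    = x
nth (_ ∷ xs) (suc i) = nth xs i

-- 1-based letter π_x
at : List ℕ → ℕ → ℕ
at π x = nth π (x ∸ 1)

IsPerm : List ℕ → Set
IsPerm w = w ↭ map suc (upTo (length w))

-- standardisation: each letter replaced by its rank (1 + number of smaller letters)
fl : List ℕ → List ℕ
fl w = map (λ a → suc (length (filter (_<? a) w))) w

-- occurrence of p in π at (1-based) indices js, j_1 < ... < j_k
Occurrence : List ℕ → List ℕ → List ℕ → Set
Occurrence π p js =
  Linked _<_ js × All (λ x → 1 ≤ x × x ≤ length π) js ×
  length js ≡ length p × fl (map (at π) js) ≡ p

Contains : List ℕ → List ℕ → Set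
Contains π p = ∃[ js ] Occurrence π p js

Avoids : (List ℕ → Set) → List ℕ → Set
Avoids P π = ∀ p → P p → ¬ Contains π p

Av : (List ℕ → Set) → List ℕ → Set
Av P π = IsPerm π × Avoids P π

AvLe : (List ℕ → Set) → ℕ → List ℕ → Set
AvLe P n π = Av P π × length π ≤ n

-- a shading of a pattern of length k: R[a][b] = true iff box (a,b) ∈ R, a,b ∈ {0..k}
Shading : ℕ → Set
Shading k = Vec (Vec Bool (suc k)) (suc k)

_∈ₛ_ : ∀ {k} → Fin (suc k) × Fin (suc k) → Shading k → Set
_∈ₛ_ (a Data.Product., b) R = lookup (lookup R a) b ≡ true

_⊆ₛ_ : ∀ {k} → Shading k → Shading k → Set
R ⊆ₛ S = ∀ a b → (a Data.Product., b) ∈ₛ R → (a Data.Product., b) ∈ₛ S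

fullShading : (k : ℕ) → Shading k
fullShading k = replicate (suc k) (replicate (suc k) true)

-- j_0 = 0, j_1..j_k, j_{k+1} = n+1
posList : List ℕ → List ℕ → List ℕ
posList π js = 0 ∷ js ++ [ suc (length π) ]

-- v_0 = 0 < sorted occurrence values < v_{k+1} = n+1
valList : List ℕ → List ℕ → List ℕ
valList π js = 0 ∷ sort (map (at π) js) ++ [ suc (length π) ]

EmptyBox : List ℕ → List ℕ → ℕ → ℕ → Set
EmptyBox π js a b =
  ∀ x → nth (posList π js) a < x → x < nth (posList π js) (suc a) →
  ¬ (nth (valList π js) b < at π x × at π x < nth (valList π js) (suc b))

IsMaxShading : ∀ {k} → List ℕ → List ℕ → Shading k → Set
IsMaxShading π js R =
  ∀ a b → ((a Data.Product., b) ∈ₛ R) ⇔ EmptyBox π js (toℕ a) (toℕ b)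

OccShading : (List ℕ → Set) → (p : List ℕ) → Shading (length p) → Set
OccShading B p R = ∃[ π ] B π × ∃[ js ] Occurrence π p js × IsMaxShading π js R

Sh : (List ℕ → Set) → (p : List ℕ) → Shading (length p) → Set
Sh B p R = OccShading B p R × (∀ S → OccShading B p S → R ⊆ₛ S → S ≡ R)

-- (q , sh_q) is in the output of Mine(B, m): q is a classical pattern of length ≤ m
-- (the second component is by definition Sh B q)
InMine : ℕ → List ℕ → Set
InMine m q = IsPerm q × length q ≤ m

module Submission where

-- Let (q , sh_q) be mined from A_{≤n} = Av(P)_{≤n} with
-- sh_q nonempty. Then q occurs, at some indices js, in some π ∈ Av(P) of
-- length at most n, and three facts follow.
--   * q ∉ P, because π avoids P but contains q.
--   * q itself lies in A_{≤n}: it is a permutation, it is no longer than π,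
--     and it avoids P since containment is transitive (an occurrence of p in q,
--     read through the occurrence js of q in π, is an occurrence of p in π).
--   * q is standardised (fl q = q, as fl is idempotent), so 1,…,k is an
--     occurrence of q in q; it has every box empty, as its consecutive
--     positions differ by one; so the full shading is realised,
--     and being the top element for ⊆ it is the only inclusion-maximal one.

open import Defs
open import Data.Nat using (ℕ; zero; suc; _+_; _≤_; _<_; _<?_; z≤n; s≤s)
open import Data.Nat.Properties
  using (suc-injective; ≤-refl; ≤-trans; ≤-pred; <-trans; <-≤-trans; <⇒≤; <⇒≱; ≮⇒≥; n<1+n;
         m≤n⇒m≤1+n; m<n⇒m<1+n; m≤m+n; +-comm; +-suc; +-identityʳ; +-monoʳ-≤)
open import Data.Fin using (toℕ)
open import Data.Fin.Properties using (toℕ<n)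
open import Data.List using (List; []; _∷_; length; map; filter; _++_; [_])
open import Data.List.Properties using (length-map; filter-accept; filter-reject; map-∘; map-cong-local)
open import Data.List.Relation.Unary.All using (All; []; _∷_)
import Data.List.Relation.Unary.All as All
open import Data.List.Relation.Unary.All.Properties using (map⁺)
open import Data.List.Relation.Unary.Linked using (Linked; []; [-]; _∷_)
open import Data.Vec using (Vec; lookup)
open import Data.Vec.Properties using (lookup-replicate; tabulate∘lookup; tabulate-cong)
open import Data.Product using (_×_; _,_; proj₁; proj₂; ∃)
open import Data.Empty using (⊥-elim)
open import Relation.Binary.PropositionalEquality using (_≡_; refl; sym; trans; cong; cong₂; subst; module ≡-Reasoning)
open import Relation.Nullary using (¬_; yes; no)
open import Function.Bundles using (_⇔_; mk⇔; Equivalence)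

open Equivalence using (to; from)

nth-ext : (u v : List ℕ) → length u ≡ length v →
  (∀ i → i < length u → nth u i ≡ nth v i) → u ≡ v
nth-ext []      []      _ _ = refl
nth-ext (x ∷ u) (y ∷ v) e h =
  cong₂ _∷_ (h 0 (s≤s z≤n)) (nth-ext u v (suc-injective e) (λ i i< → h (suc i) (s≤s i<)))

nth-map : (f : ℕ → ℕ) (l : List ℕ) (i : ℕ) → i < length l → nth (map f l) i ≡ f (nth l i)
nth-map f (x ∷ l) zero    _       = refl
nth-map f (x ∷ l) (suc i) (s≤s p) = nth-map f l i p

nth-All : ∀ {Q : ℕ → Set} (l : List ℕ) (i : ℕ) → All Q l → i < length l → Q (nth l i)
nth-All (x ∷ l) zero    (qx ∷ _)  _       = qx
nth-All (x ∷ l) (suc i) (_ ∷ ql) (s≤s p) = nth-All l i ql p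

nth-increasing : (js : List ℕ) → Linked _<_ js →
  ∀ i j → i < j → j < length js → nth js i < nth js j
nth-increasing (x ∷ [])     [-]     _ (suc _) _ (s≤s ())
nth-increasing (x ∷ y ∷ xs) (p ∷ L) zero (suc zero) _ _ = p
nth-increasing (x ∷ y ∷ xs) (p ∷ L) zero (suc (suc j)) _ (s≤s jl) =
  <-trans p (nth-increasing (y ∷ xs) L 0 (suc j) (s≤s z≤n) jl)
nth-increasing (x ∷ y ∷ xs) (p ∷ L) (suc i) (suc j) (s≤s ij) (s≤s jl) =
  nth-increasing (y ∷ xs) L i j ij jl

InRange : ℕ → ℕ → Set
InRange N x = 1 ≤ x × x ≤ N

at-map : (f : ℕ → ℕ) (l : List ℕ) (x : ℕ) → InRange (length l) x → at (map f l) x ≡ f (at l x)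
at-map f l (suc x) (_ , x<) = nth-map f l x x<

map-select : (f : ℕ → ℕ) (l is : List ℕ) → All (InRange (length l)) is →
  map f (map (at l) is) ≡ map (at (map f l)) is
map-select f l is rs =
  trans (sym (map-∘ is)) (map-cong-local (All.map (λ {x} r → sym (at-map f l x r)) rs))

below : ℕ → List ℕ → ℕ
below a w = length (filter (_<? a) w)

below-∷-yes : {z a : ℕ} (w : List ℕ) → z < a → below a (z ∷ w) ≡ suc (below a w)
below-∷-yes {a = a} w z<a = cong length (filter-accept (_<? a) z<a)

below-∷-no : {z a : ℕ} (w : List ℕ) → ¬ z < a → below a (z ∷ w) ≡ below a w
below-∷-no {a = a} w z≮a = cong length (filter-reject (_<? a) z≮a)

below-mono : (w : List ℕ) {x y : ℕ} → x ≤ y → below x w ≤ below y w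
below-mono []      _ = z≤n
below-mono (z ∷ w) {x} {y} x≤y with z <? x | z <? y
... | yes z<x | yes z<y rewrite below-∷-yes w z<x | below-∷-yes w z<y = s≤s (below-mono w x≤y)
... | no z≮x  | no z≮y  rewrite below-∷-no w z≮x  | below-∷-no w z≮y  = below-mono w x≤y
... | no z≮x  | yes z<y rewrite below-∷-no w z≮x  | below-∷-yes w z<y = m≤n⇒m≤1+n (below-mono w x≤y)
... | yes z<x | no z≮y  = ⊥-elim (z≮y (<-≤-trans z<x x≤y))

below-strict : (w : List ℕ) {x y : ℕ} (k : ℕ) → k < length w →
  x ≤ nth w k → nth w k < y → below x w < below y w
below-strict (z ∷ w) {x} {y} zero _ x≤z z<y with z <? x | z <? y
... | yes z<x | _       = ⊥-elim (<⇒≱ z<x x≤z)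
... | no z≮x  | yes z<y rewrite below-∷-no w z≮x | below-∷-yes w z<y =
  s≤s (below-mono w (≤-trans x≤z (<⇒≤ z<y)))
... | no _    | no z≮y  = ⊥-elim (z≮y z<y)
below-strict (z ∷ w) {x} {y} (suc k) (s≤s k<) x≤wk wk<y with z <? x | z <? y
... | yes z<x | yes z<y rewrite below-∷-yes w z<x | below-∷-yes w z<y = s≤s (below-strict w k k< x≤wk wk<y)
... | no z≮x  | no z≮y  rewrite below-∷-no w z≮x  | below-∷-no w z≮y  = below-strict w k k< x≤wk wk<y
... | no z≮x  | yes z<y rewrite below-∷-no w z≮x  | below-∷-yes w z<y = m<n⇒m<1+n (below-strict w k k< x≤wk wk<y)
... | yes z<x | no z≮y  = ⊥-elim (z≮y (<-≤-trans z<x (≤-trans x≤wk (<⇒≤ wk<y))))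

below-cong : (u v : List ℕ) (a b : ℕ) → length u ≡ length v →
  (∀ k → k < length u → (nth u k < a ⇔ nth v k < b)) → below a u ≡ below b v
below-cong []      []      a b _ _ = refl
below-cong (x ∷ u) (y ∷ v) a b e h with x <? a | y <? b
... | yes x<a | yes y<b rewrite below-∷-yes u x<a | below-∷-yes v y<b =
  cong suc (below-cong u v a b (suc-injective e) (λ k k< → h (suc k) (s≤s k<)))
... | no x≮a  | no y≮b  rewrite below-∷-no u x≮a  | below-∷-no v y≮b  =
  below-cong u v a b (suc-injective e) (λ k k< → h (suc k) (s≤s k<))
... | yes x<a | no y≮b  = ⊥-elim (y≮b (to (h 0 (s≤s z≤n)) x<a))
... | no x≮a  | yes y<b = ⊥-elim (x≮a (from (h 0 (s≤s z≤n)) y<b))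

nth-fl : (w : List ℕ) (i : ℕ) → i < length w → nth (fl w) i ≡ suc (below (nth w i) w)
nth-fl w i i< = nth-map (λ a → suc (below a w)) w i i<

length-fl : (w : List ℕ) → length (fl w) ≡ length w
length-fl w = length-map _ w

SameOrder : List ℕ → List ℕ → Set
SameOrder u v = length u ≡ length v ×
  (∀ i j → i < length u → j < length u → (nth u j < nth u i ⇔ nth v j < nth v i))

sameOrder-sym : {u v : List ℕ} → SameOrder u v → SameOrder v u
sameOrder-sym {u} (e , h) = sym e , λ i j i< j< →
  let cmp = h i j (subst (i <_) (sym e) i<) (subst (j <_) (sym e) j<)
  in mk⇔ (from cmp) (to cmp)

fl-sameOrder : (w : List ℕ) → SameOrder w (fl w)
fl-sameOrder w = sym (length-fl w) , cmp
  where
  cmp : ∀ i j → i < length w → j < length w → (nth w j < nth w i ⇔ nth (fl w) j < nth (fl w) i)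
  cmp i j i< j< rewrite nth-fl w i i< | nth-fl w j j< = mk⇔ rank< <rank
    where
    rank< : nth w j < nth w i → suc (below (nth w j) w) < suc (below (nth w i) w)
    rank< wj<wi = s≤s (below-strict w j j< ≤-refl wj<wi)
    <rank : suc (below (nth w j) w) < suc (below (nth w i) w) → nth w j < nth w i
    <rank (s≤s r<) with nth w j <? nth w i
    ... | yes wj<wi = wj<wi
    ... | no wj≮wi  = ⊥-elim (<⇒≱ r< (below-mono w (≮⇒≥ wj≮wi)))

sameOrder-fl : {u v : List ℕ} → SameOrder u v → fl u ≡ fl v
sameOrder-fl {u} {v} (e , h) = nth-ext (fl u) (fl v) lengths λ i i< →
  let i<u = subst (i <_) (length-fl u) i<
  in begin
    nth (fl u) i                ≡⟨ nth-fl u i i<u ⟩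
    suc (below (nth u i) u)     ≡⟨ cong suc (below-cong u v (nth u i) (nth v i) e (λ k k< → h i k i<u k<)) ⟩
    suc (below (nth v i) v)     ≡⟨ sym (nth-fl v i (subst (i <_) e i<u)) ⟩
    nth (fl v) i                ∎
  where
  open ≡-Reasoning
  lengths : length (fl u) ≡ length (fl v)
  lengths = trans (length-fl u) (trans e (sym (length-fl v)))

fl-idempotent : (w : List ℕ) → fl (fl w) ≡ fl w
fl-idempotent w = sameOrder-fl {fl w} {w} (sameOrder-sym {w} {fl w} (fl-sameOrder w))

sameOrder-select : {u v : List ℕ} → SameOrder u v → (is : List ℕ) → All (InRange (length u)) is →
  SameOrder (map (at u) is) (map (at v) is)
sameOrder-select {u} {v} (e , h) is rs =
  trans (length-map _ is) (sym (length-map _ is)) , λ i j i< j< →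
    cmp i j (subst (i <_) (length-map _ is) i<) (subst (j <_) (length-map _ is) j<)
  where
  cmp : ∀ i j → i < length is → j < length is →
    (nth (map (at u) is) j < nth (map (at u) is) i ⇔ nth (map (at v) is) j < nth (map (at v) is) i)
  cmp i j i< j<
    rewrite nth-map (at u) is i i< | nth-map (at u) is j j<
          | nth-map (at v) is i i< | nth-map (at v) is j j<
    with nth is i | nth-All is i rs i< | nth is j | nth-All is j rs j<
  ... | suc x | (_ , x<) | suc y | (_ , y<) = h x y x< y<

pattern-standard : (π js : List ℕ) {p : List ℕ} → Occurrence π p js → fl p ≡ p
pattern-standard π js (_ , _ , _ , refl) = fl-idempotent (map (at π) js)

linked-select : (js is : List ℕ) → Linked _<_ js → Linked _<_ is → All (InRange (length js)) is →
  Linked _<_ (map (at js) is)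
linked-select js []                  _   _         _ = []
linked-select js (x ∷ [])            _   _         _ = [-]
linked-select js (suc x ∷ suc y ∷ r) Ljs (s≤s x<y ∷ L) (_ ∷ ry@(_ , y<) ∷ rs) =
  nth-increasing js Ljs x y x<y y< ∷ linked-select js (suc y ∷ r) Ljs L (ry ∷ rs)

occurrence-trans : (π q p js is : List ℕ) → Occurrence π q js → Occurrence q p is →
  Occurrence π p (map (at js) is)
occurrence-trans π q p js is (Ljs , rjs , ljs , refl) (Lis , ris , lis , fis) =
  linked-select js is Ljs Lis ris-js ,
  map⁺ (All.map (λ { {suc x} (_ , x<) → nth-All js x rjs x< }) ris-js) ,
  trans (length-map (at js) is) lis ,
  (begin
    fl (map (at π) (map (at js) is))   ≡⟨ cong fl (map-select (at π) js is ris-js) ⟩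
    fl (map (at w) is)                 ≡⟨ sameOrder-fl (sameOrder-select {w} {fl w} (fl-sameOrder w) is ris-w) ⟩
    fl (map (at (fl w)) is)            ≡⟨ fis ⟩
    p                                  ∎)
  where
  open ≡-Reasoning
  w : List ℕ
  w = map (at π) js
  ris-js : All (InRange (length js)) is
  ris-js = subst (λ N → All (InRange N) is) (trans (length-fl w) (length-map (at π) js)) ris
  ris-w : All (InRange (length w)) is
  ris-w = subst (λ N → All (InRange N) is) (length-fl w) ris

avoids-pattern : {P : List ℕ → Set} (π q js : List ℕ) → Avoids P π → Occurrence π q js → Avoids P q
avoids-pattern π q js π-av occ p Pp (is , occ′) =
  π-av p Pp (_ , occurrence-trans π q p js is occ occ′)

increasing-bound : (x : ℕ) (xs : List ℕ) (N : ℕ) → Linked _<_ (x ∷ xs) → All (InRange N) (x ∷ xs) →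
  length xs + x ≤ N
increasing-bound x []       N _          ((_ , x≤) ∷ _) = x≤
increasing-bound x (y ∷ ys) N (x<y ∷ L) (_ ∷ rs) =
  ≤-trans (subst (_≤ length ys + y) (+-suc (length ys) x) (+-monoʳ-≤ (length ys) x<y))
          (increasing-bound y ys N L rs)

increasing-length : (js : List ℕ) (N : ℕ) → Linked _<_ js → All (InRange N) js → length js ≤ N
increasing-length []       N _ _ = z≤n
increasing-length (x ∷ xs) N L rs@((1≤x , _) ∷ _) =
  ≤-trans (subst (_≤ length xs + x) (+-comm (length xs) 1) (+-monoʳ-≤ (length xs) 1≤x))
          (increasing-bound x xs N L rs)

occurrence-length : (π js : List ℕ) {p : List ℕ} → Occurrence π p js → length p ≤ length π
occurrence-length π js (L , rs , ljs , _) =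
  subst (_≤ length π) ljs (increasing-length js (length π) L rs)

interval : ℕ → ℕ → List ℕ
interval s zero    = []
interval s (suc k) = s ∷ interval (suc s) k

length-interval : (s k : ℕ) → length (interval s k) ≡ k
length-interval s zero    = refl
length-interval s (suc k) = cong suc (length-interval (suc s) k)

nth-interval : (s k i : ℕ) → i < k → nth (interval s k) i ≡ s + i
nth-interval s (suc k) zero    _       = sym (+-identityʳ s)
nth-interval s (suc k) (suc i) (s≤s p) = trans (nth-interval (suc s) k i p) (sym (+-suc s i))

interval-snoc : (s k : ℕ) → interval s k ++ [ s + k ] ≡ interval s (suc k)
interval-snoc s zero    = cong [_] (+-identityʳ s)
interval-snoc s (suc k) =
  cong (s ∷_) (trans (cong (λ t → interval (suc s) k ++ [ t ]) (+-suc s k)) (interval-snoc (suc s) k))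

linked-interval : (s k : ℕ) → Linked _<_ (interval s k)
linked-interval s zero          = []
linked-interval s (suc zero)    = [-]
linked-interval s (suc (suc k)) = n<1+n s ∷ linked-interval (suc s) (suc k)

range-interval : (s k : ℕ) → All (λ x → suc s ≤ x × x ≤ s + k) (interval (suc s) k)
range-interval s zero    = []
range-interval s (suc k) rewrite +-suc s k =
  (≤-refl , s≤s (m≤m+n s k)) ∷ All.map (λ (s<x , x≤) → <⇒≤ s<x , x≤) (range-interval (suc s) k)

select-all : (q : List ℕ) → map (at q) (interval 1 (length q)) ≡ q
select-all q = nth-ext _ q lengths λ i i< →
  let i<k = subst (i <_) (length-map (at q) (interval 1 (length q))) i<
  in trans (nth-map (at q) (interval 1 (length q)) i i<k)
           (cong (at q) (nth-interval 1 (length q) i (subst (i <_) (length-interval 1 (length q)) i<k)))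
  where
  lengths : length (map (at q) (interval 1 (length q))) ≡ length q
  lengths = trans (length-map (at q) (interval 1 (length q))) (length-interval 1 (length q))

trivial-occurrence : (q : List ℕ) → fl q ≡ q → Occurrence q q (interval 1 (length q))
trivial-occurrence q flq =
  linked-interval 1 (length q) , range-interval 0 (length q) , length-interval 1 (length q) ,
  trans (cong fl (select-all q)) flq

trivial-positions : (q : List ℕ) (a : ℕ) → a < suc (suc (length q)) →
  nth (posList q (interval 1 (length q))) a ≡ a
trivial-positions q a a< =
  trans (cong (λ l → nth l a) (cong (0 ∷_) (interval-snoc 1 (length q))))
        (nth-interval 0 (suc (suc (length q))) a a<)

-- Every box of the trivial occurrence is empty: no index lies strictly
-- between two consecutive positions a and a+1.
trivial-emptyBox : (q : List ℕ) (a b : ℕ) → a ≤ length q → EmptyBox q (interval 1 (length q)) a b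
trivial-emptyBox q a b a≤ x a<x x<a+1 _ rewrite trivial-positions q a (s≤s (m≤n⇒m≤1+n a≤))
                                              | trivial-positions q (suc a) (s≤s (s≤s a≤)) =
  <⇒≱ a<x (≤-pred x<a+1)

lookup-ext : ∀ {A : Set} {k : ℕ} (u v : Vec A k) → (∀ i → lookup u i ≡ lookup v i) → u ≡ v
lookup-ext u v h = trans (sym (tabulate∘lookup u)) (trans (tabulate-cong h) (tabulate∘lookup v))

∈-full : (k : ℕ) → ∀ a b → (a , b) ∈ₛ fullShading k
∈-full k a b = trans (cong (λ row → lookup row b) (lookup-replicate a _)) (lookup-replicate b _)

full-top : (k : ℕ) (S : Shading k) → fullShading k ⊆ₛ S → S ≡ fullShading k
full-top k S sub = lookup-ext S (fullShading k) λ a →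
  lookup-ext (lookup S a) (lookup (fullShading k) a) λ b →
    trans (sub a b (∈-full k a b)) (sym (∈-full k a b))

full-realised : {B : List ℕ → Set} (q : List ℕ) → B q → fl q ≡ q →
  OccShading B q (fullShading (length q))
full-realised q Bq flq =
  q , Bq , interval 1 (length q) , trivial-occurrence q flq , λ a b →
    mk⇔ (λ _ → trivial-emptyBox q (toℕ a) (toℕ b) (≤-pred (toℕ<n a)))
        (λ _ → ∈-full (length q) a b)

full-unique : {B : List ℕ → Set} (q : List ℕ) → OccShading B q (fullShading (length q)) →
  Sh B q (fullShading (length q)) × (∀ R → Sh B q R → R ≡ fullShading (length q))
full-unique q occ =
  (occ , λ S _ sub → full-top (length q) S sub) ,
  λ R (_ , maximal) → sym (maximal (fullShading (length q)) occ (λ a b _ → ∈-full (length q) a b))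

lemma2p2 : (P : List ℕ → Set) → (∀ p → P p → IsPerm p) →
    (n m : ℕ) → 1 ≤ n → 1 ≤ m →
    (q : List ℕ) → InMine m q →
    ∃ (λ R → Sh (AvLe P n) q R) →
    ¬ P q × Sh (AvLe P n) q (fullShading (length q)) ×
      (∀ R → Sh (AvLe P n) q R → R ≡ fullShading (length q))
lemma2p2 P _ n m _ _ q (q-perm , _) (_ , (π , ((_ , π-avoids) , π-short) , js , occ , _) , _) =
  q∉P , proj₁ full-maximal , proj₂ full-maximal
  where
  q∉P : ¬ P q
  q∉P Pq = π-avoids q Pq (js , occ)
  q∈A : AvLe P n q
  q∈A = (q-perm , avoids-pattern π q js π-avoids occ) , ≤-trans (occurrence-length π js occ) π-short
  full-maximal : Sh (AvLe P n) q (fullShading (length q)) ×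
                 (∀ R → Sh (AvLe P n) q R → R ≡ fullShading (length q))
  full-maximal = full-unique q (full-realised q q∈A (pattern-standard π js occ))
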